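{- Let $G$ be a graph and let $U\subseteq V(G)$. Then $\chi_o(G)\le |U|+\chi_o(G\setminus E(G[U]))$, where $G\setminus E(G[U])$ is the graph obtained from $G$ by deleting all edges with both endpoints in $U$.
   Context: Graphs are finite and simple. An oriented graph is a directed graph with no loops, multiple arcs or pairs of opposite arcs. For an oriented graph $\vec G$, an oriented coloring is a proper vertex coloring $\phi$ such that for any two arcs $uv$ and $v'u'$, $(\phi(u),\phi(v))\ne(\phi(u'),\phi(v'))$; $\chi_o(\vec G)$ is the minimum number of colors of such a coloring, and for an undirected $G$, $\chi_o(G)$ is the maximum of $\chi_o(\vec G)$ over all orientations of $G$. -}

module Defs where

open import Data.Nat using (ℕ)
open import Data.Fin using (Fin)
open import Data.Fin.Subset using (Subset; _∈_)
open import Data.Product using (_×_; _,_)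
open import Data.Sum using (_⊎_)
open import Relation.Nullary using (¬_)
open import Relation.Binary.PropositionalEquality using (_≡_)

record Graph : Set₁ where
  field
    n     : ℕ
    Adj   : Fin n → Fin n → Set
    sym   : ∀ {u v} → Adj u v → Adj v u
    irr   : ∀ {u} → ¬ Adj u u
open Graph public

record Orientation (G : Graph) : Set₁ where
  field
    Arc      : Fin (n G) → Fin (n G) → Set
    arc⇒edge : ∀ {u v} → Arc u v → Adj G u v
    edge⇒arc : ∀ {u v} → Adj G u v → Arc u v ⊎ Arc v u
    antisym  : ∀ {u v} → Arc u v → ¬ Arc v u
open Orientation public

record OrientedColoring {G : Graph} (O : Orientation G) (k : ℕ) : Set where
  field
    φ      : Fin (n G) → Fin k
    proper : ∀ {u v} → Arc O u v → ¬ (φ u ≡ φ v)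
    orient : ∀ {u v u' v'} → Arc O u v → Arc O v' u' →
             ¬ (φ u ≡ φ u' × φ v ≡ φ v')
open OrientedColoring public

-- χ_o(G) ≤ k : every orientation of G admits an oriented coloring with
-- (at most) k colors.  (χ_o(G) = max over orientations of χ_o(O).)
χo≤ : Graph → ℕ → Set₁
χo≤ G k = (O : Orientation G) → OrientedColoring O k

deleteInside : (G : Graph) → Subset (n G) → Graph
deleteInside G U = record
  { n   = n G
  ; Adj = λ u v → Adj G u v × ¬ (u ∈ U × v ∈ U)
  ; sym = λ { (e , h) → sym G e , λ { (a , b) → h (b , a) } }
  ; irr = λ { (e , _) → irr G e }
  }

{-# OPTIONS --safe #-}
module Submission where

open import Defs
open import Data.Nat using (ℕ; _+_)
open import Data.Fin using (Fin; zero; suc; join; splitAt)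
open import Data.Fin.Properties using (suc-injective; splitAt-join)
open import Data.Fin.Subset using (Subset; ∣_∣; _∈_)
open import Data.Fin.Subset.Properties using (_∈?_)
open import Data.Vec using (_∷_; here; there)
open import Data.Bool using (true; false)
open import Data.Sum using (_⊎_; inj₁; inj₂; map)
open import Data.Sum.Properties using (inj₁-injective; inj₂-injective)
open import Data.Empty using (⊥-elim)
open import Data.Product using (_×_; _,_)
open import Function using (_∘_)
open import Function.Definitions using (Injective)
open import Relation.Nullary using (¬_; yes; no)
open import Relation.Nullary.Decidable using (_×-dec_)
open import Relation.Binary.PropositionalEquality
  using (_≡_; refl; cong; subst; module ≡-Reasoning)
  renaming (sym to ≡-sym)

-- Restrict an orientation of G to G ∖ E(G[U]) and color it with k colors;
-- then give every vertex of U a color of its own.  The new coloring refines the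
-- old one, so a conflict between arcs not both inside U is a conflict of the
-- old coloring, while two arcs inside U with the same color pair join the same
-- two vertices and so cannot be opposite.

index : ∀ {m} (U : Subset m) {u : Fin m} → u ∈ U → Fin ∣ U ∣
index (true  ∷ U) here      = zero
index (true  ∷ U) (there p) = suc (index U p)
index (false ∷ U) (there p) = index U p

index-injective : ∀ {m} (U : Subset m) {u v : Fin m} (p : u ∈ U) (q : v ∈ U) →
                  index U p ≡ index U q → u ≡ v
index-injective (true  ∷ U) here      here      _ = refl
index-injective (true  ∷ U) (there p) (there q) e =
  cong suc (index-injective U p q (suc-injective e))
index-injective (false ∷ U) (there p) (there q) e =
  cong suc (index-injective U p q e)

join-injective : ∀ m n → Injective _≡_ _≡_ (join m n)
join-injective m n {i} {j} e = begin
  i                      ≡⟨ ≡-sym (splitAt-join m n i) ⟩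
  splitAt m (join m n i) ≡⟨ cong (splitAt m) e ⟩
  splitAt m (join m n j) ≡⟨ splitAt-join m n j ⟩
  j                      ∎
  where open ≡-Reasoning

Refines : ∀ {m} {A B : Set} → (Fin m → A) → (Fin m → B) → Set
Refines φ ψ = ∀ {u v} → φ u ≡ φ v → ψ u ≡ ψ v

OwnColorsOn : ∀ {m} {A : Set} → Subset m → (Fin m → A) → Set
OwnColorsOn U φ = ∀ {u v} → φ u ≡ φ v → u ∈ U → u ≡ v

ownColorsOn-∈ : ∀ {m} {A : Set} {U : Subset m} {φ : Fin m → A} → OwnColorsOn U φ →
                 ∀ {u v} → φ u ≡ φ v → v ∈ U → u ∈ U
ownColorsOn-∈ {U = U} own e v∈U = subst (_∈ U) (own (≡-sym e) v∈U) v∈U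

module _ {G : Graph} (U : Subset (n G)) where

  restrictOrientation : Orientation G → Orientation (deleteInside G U)
  restrictOrientation O = record
    { Arc      = λ u v → Arc O u v × ¬ (u ∈ U × v ∈ U)
    ; arc⇒edge = λ { (a , h) → arc⇒edge O a , h }
    ; edge⇒arc = λ { (e , h) → map (_, h) (_, λ { (p , q) → h (q , p) })
                                              (edge⇒arc O e) }
    ; antisym  = λ { (a , _) (b , _) → antisym O a b }
    }

  liftColoring : (O : Orientation G) {k m : ℕ}
                  (C : OrientedColoring (restrictOrientation O) k)
                  (χ : Fin (n G) → Fin m) →
                  Refines χ (φ C) → OwnColorsOn U χ → OrientedColoring O m
  liftColoring O C χ refines own = record
    { φ      = χ
    ; proper = proper′
    ; orient = orient′
    }
    where
    proper′ : ∀ {u v} → Arc O u v → ¬ (χ u ≡ χ v)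
    proper′ {u} a e with u ∈? U
    ... | yes u∈U with own e u∈U
    ...   | refl = irr G (arc⇒edge O a)
    proper′ a e | no u∉U = proper C (a , λ { (u∈U , _) → u∉U u∈U }) (refines e)

    orient′ : ∀ {u v u' v'} → Arc O u v → Arc O v' u' →
              ¬ (χ u ≡ χ u' × χ v ≡ χ v')
    orient′ {u} {v} a b (e₁ , e₂) with (u ∈? U) ×-dec (v ∈? U)
    ... | yes (u∈U , v∈U) with own e₁ u∈U | own e₂ v∈U
    ...   | refl | refl = antisym O a b
    orient′ a b (e₁ , e₂) | no outside =
      orient C (a , outside)
        (b , λ { (v'∈U , u'∈U) → outside (ownColorsOn-∈ own e₁ u'∈U ,
                                          ownColorsOn-∈ own e₂ v'∈U) })
        (refines e₁ , refines e₂)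

module _ {m k : ℕ} (U : Subset m) (ψ : Fin m → Fin k) where

  separate : Fin m → Fin ∣ U ∣ ⊎ Fin k
  separate u with u ∈? U
  ... | yes u∈U = inj₁ (index U u∈U)
  ... | no  _   = inj₂ (ψ u)

  separate-refines : Refines separate ψ
  separate-refines {u} {v} e with u ∈? U | v ∈? U
  ... | yes p | yes q = cong ψ (index-injective U p q (inj₁-injective e))
  ... | no _  | no _  = inj₂-injective e

  separate-ownColors : OwnColorsOn U separate
  separate-ownColors {u} {v} e u∈U with u ∈? U | v ∈? U
  ... | yes p | yes q = index-injective U p q (inj₁-injective e)
  ... | no u∉U | _    = ⊥-elim (u∉U u∈U)

lemma4p2 : (G : Graph) (U : Subset (n G)) (k : ℕ) →
    χo≤ (deleteInside G U) k → χo≤ G (∣ U ∣ + k)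
lemma4p2 G U k χo≤k O =
  liftColoring U O C (join ∣ U ∣ k ∘ separate U ψ)
    (separate-refines U ψ ∘ join-injective ∣ U ∣ k)
    (separate-ownColors U ψ ∘ join-injective ∣ U ∣ k)
  where
  C : OrientedColoring (restrictOrientation U O) k
  C = χo≤k (restrictOrientation U O)

  ψ : Fin (n G) → Fin k
  ψ = φ C
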